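{- Let $F$ be a $2$PC formula, $P$ a PC formula, and $v:V\to\{1,2\}$ an environment, with associated classical valuation $w_v$ ($w_v(X)=1$ if $v(X)=1$, $w_v(X)=0$ if $v(X)=2$). Then $[\![F]\!]_v=1$ iff $F^\bullet$ is true under $w_v$, and $P$ is true under $w_v$ iff $[\![P^\circ]\!]_v=1$.
   Context: $2$PC is the case $n=2$ of the following: formulas are decorated variables $X^{id}$, $X^{(12)}$ ($X\in V$, $V$ a countable set of variables, $id$ the identity and $(12)$ the transposition of $\{1,2\}$), constants $\mathsf e_1,\mathsf e_2$, and compound formulas $q(F,G_1,G_2)$. For $\rho\in S_2$, $(X^\pi)^\rho=X^{\rho\circ\pi}$, $(\mathsf e_k)^\rho=\mathsf e_{\rho(k)}$, $q(F,G_1,G_2)^\rho=q(F,G_1^\rho,G_2^\rho)$. Semantics: for $v:V\to\{1,2\}$, $[\![X^\pi]\!]_v=\pi(v(X))$, $[\![\mathsf e_i]\!]_v=i$, $[\![q(F,G_1,G_2)]\!]_v=[\![G_k]\!]_v$ with $k=[\![F]\!]_v$. PC formulas are built from constants $0,1$, variables $X\in V$ and connectives $\neg,\wedge,\vee$, evaluated classically under valuations $w:V\to\{0,1\}$. Translations: $0^\circ=\mathsf e_2$, $1^\circ=\mathsf e_1$, $X^\circ=X^{id}$, $(\neg P)^\circ=(P^\circ)^{(12)}$, $(P\wedge Q)^\circ=q(P^\circ,Q^\circ,\mathsf e_2)$, $(P\vee Q)^\circ=q(P^\circ,\mathsf e_1,Q^\circ)$; and $\mathsf e_2^\bullet=0$,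 $\mathsf e_1^\bullet=1$, $(X^{id})^\bullet=X$, $(X^{(12)})^\bullet=\neg X$, $q(F,G,H)^\bullet=(F^\bullet\wedge G^\bullet)\vee(\neg F^\bullet\wedge H^\bullet)$. -}

module Defs where

open import Data.Nat using (ℕ)
open import Data.Bool using (Bool; true; false; not; _∧_; _∨_)

Var : Set
Var = ℕ

data Two : Set where
  ①  : Two
  ②  : Two

data S₂ : Set where
  ι    : S₂
  τ₁₂  : S₂

act : S₂ → Two → Two
act ι   k = k
act τ₁₂ ① = ②
act τ₁₂ ② = ①

_∘ₚ_ : S₂ → S₂ → S₂
ι   ∘ₚ π   = π
τ₁₂ ∘ₚ ι   = τ₁₂
τ₁₂ ∘ₚ τ₁₂ = ι

data Form2 : Set where
  var : Var → S₂ → Form2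
  e   : Two → Form2
  q   : Form2 → Form2 → Form2 → Form2

_^_ : Form2 → S₂ → Form2
var X π  ^ ρ = var X (ρ ∘ₚ π)
e k      ^ ρ = e (act ρ k)
q F G₁ G₂ ^ ρ = q F (G₁ ^ ρ) (G₂ ^ ρ)

⟦_⟧ : Form2 → (Var → Two) → Two
⟦ var X π ⟧ v = act π (v X)
⟦ e k ⟧ v = k
⟦ q F G₁ G₂ ⟧ v with ⟦ F ⟧ v
... | ① = ⟦ G₁ ⟧ v
... | ② = ⟦ G₂ ⟧ v

data PC : Set where
  𝟘 𝟙  : PC
  pvar : Var → PC
  ¬'_  : PC → PC
  _∧'_ : PC → PC → PC
  _∨'_ : PC → PC → PC

evalPC : PC → (Var → Bool) → Bool
evalPC 𝟘 w = false
evalPC 𝟙 w = true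
evalPC (pvar X) w = w X
evalPC (¬' P) w = not (evalPC P w)
evalPC (P ∧' Q) w = evalPC P w ∧ evalPC Q w
evalPC (P ∨' Q) w = evalPC P w ∨ evalPC Q w

_° : PC → Form2
𝟘 ° = e ②
𝟙 ° = e ①
pvar X ° = var X ι
(¬' P) ° = (P °) ^ τ₁₂
(P ∧' Q) ° = q (P °) (Q °) (e ②)
(P ∨' Q) ° = q (P °) (e ①) (Q °)

_• : Form2 → PC
e ② • = 𝟘
e ① • = 𝟙
var X ι • = pvar X
var X τ₁₂ • = ¬' pvar X
q F G H • = ((F •) ∧' (G •)) ∨' ((¬' (F •)) ∧' (H •))

w[_] : (Var → Two) → Var → Bool
w[ v ] X with v X
... | ① = true
... | ② = false

-- Identify {1,2} with the Booleans by 1 ↦ true, 2 ↦ false, so that w[ v ] is v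
-- followed by this identification. Both claims then follow from the equations
-- evalPC (F •) w[ v ] ≡ toBool ⟦ F ⟧ v  and  toBool ⟦ P ° ⟧ v ≡ evalPC P w[ v ],
-- proved by structural induction: q is if-then-else on both sides, and acting
-- by (12) on a formula negates its value.
module Submission where

open import Defs
open import Data.Bool using (Bool; true; false; not; _∧_; _∨_; if_then_else_)
open import Data.Bool.Properties using (∨-identityʳ)
open import Data.Product using (_×_; _,_)
open import Relation.Binary.PropositionalEquality using (_≡_; refl; sym; cong)
open import Function.Bundles using (_⇔_; mk⇔)
open import Function.Properties.Equivalence using () renaming (sym to sym⇔)

toBool : Two → Bool
toBool ① = true
toBool ② = false

toBool≡true⇔≡① : (t : Two) → (toBool t ≡ true) ⇔ (t ≡ ①)
toBool≡true⇔≡① ① = mk⇔ (λ _ → refl) (λ _ → refl)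
toBool≡true⇔≡① ② = mk⇔ (λ ()) (λ ())

toBool-act-τ₁₂ : (t : Two) → toBool (act τ₁₂ t) ≡ not (toBool t)
toBool-act-τ₁₂ ① = refl
toBool-act-τ₁₂ ② = refl

w[]≗toBool : (v : Var → Two) (X : Var) → w[ v ] X ≡ toBool (v X)
w[]≗toBool v X with v X
... | ① = refl
... | ② = refl

act-∘ₚ : (ρ π : S₂) (k : Two) → act (ρ ∘ₚ π) k ≡ act ρ (act π k)
act-∘ₚ ι   π   k = refl
act-∘ₚ τ₁₂ ι   k = refl
act-∘ₚ τ₁₂ τ₁₂ ① = refl
act-∘ₚ τ₁₂ τ₁₂ ② = refl

⟦^⟧ : (F : Form2) (ρ : S₂) (v : Var → Two) → ⟦ F ^ ρ ⟧ v ≡ act ρ (⟦ F ⟧ v)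
⟦^⟧ (var X π) ρ v = act-∘ₚ ρ π (v X)
⟦^⟧ (e k)     ρ v = refl
⟦^⟧ (q F G H) ρ v with ⟦ F ⟧ v
... | ① = ⟦^⟧ G ρ v
... | ② = ⟦^⟧ H ρ v

toBool-⟦q⟧ : (F G H : Form2) (v : Var → Two) →
  toBool (⟦ q F G H ⟧ v) ≡
    (if toBool (⟦ F ⟧ v) then toBool (⟦ G ⟧ v) else toBool (⟦ H ⟧ v))
toBool-⟦q⟧ F G H v with ⟦ F ⟧ v
... | ① = refl
... | ② = refl

∨-∧-not≡if : (b x y : Bool) → (b ∧ x) ∨ (not b ∧ y) ≡ (if b then x else y)
∨-∧-not≡if true  x y = ∨-identityʳ x
∨-∧-not≡if false x y = refl

evalPC-• : (F : Form2) (v : Var → Two) → evalPC (F •) w[ v ] ≡ toBool (⟦ F ⟧ v)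
evalPC-• (var X ι)   v = w[]≗toBool v X
evalPC-• (var X τ₁₂) v rewrite w[]≗toBool v X = sym (toBool-act-τ₁₂ (v X))
evalPC-• (e ①)       v = refl
evalPC-• (e ②)       v = refl
evalPC-• (q F G H)   v
  rewrite evalPC-• F v | evalPC-• G v | evalPC-• H v | toBool-⟦q⟧ F G H v
  = ∨-∧-not≡if (toBool (⟦ F ⟧ v)) (toBool (⟦ G ⟧ v)) (toBool (⟦ H ⟧ v))

toBool-⟦°⟧ : (P : PC) (v : Var → Two) → toBool (⟦ P ° ⟧ v) ≡ evalPC P w[ v ]
toBool-⟦°⟧ 𝟘        v = refl
toBool-⟦°⟧ 𝟙        v = refl
toBool-⟦°⟧ (pvar X) v = sym (w[]≗toBool v X)
toBool-⟦°⟧ (¬' P)   v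
  rewrite ⟦^⟧ (P °) τ₁₂ v | toBool-act-τ₁₂ (⟦ P ° ⟧ v) = cong not (toBool-⟦°⟧ P v)
toBool-⟦°⟧ (P ∧' Q) v
  rewrite toBool-⟦q⟧ (P °) (Q °) (e ②) v | toBool-⟦°⟧ P v | toBool-⟦°⟧ Q v
  with evalPC P w[ v ]
... | true  = refl
... | false = refl
toBool-⟦°⟧ (P ∨' Q) v
  rewrite toBool-⟦q⟧ (P °) (e ①) (Q °) v | toBool-⟦°⟧ P v | toBool-⟦°⟧ Q v
  with evalPC P w[ v ]
... | true  = refl
... | false = refl

lemma5p1 : (F : Form2) (P : PC) (v : Var → Two) →
    ((⟦ F ⟧ v ≡ ①) ⇔ (evalPC (F •) w[ v ] ≡ true))
    × ((evalPC P w[ v ] ≡ true) ⇔ (⟦ P ° ⟧ v ≡ ①))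
lemma5p1 F P v rewrite evalPC-• F v | sym (toBool-⟦°⟧ P v) =
  sym⇔ (toBool≡true⇔≡① (⟦ F ⟧ v)) , toBool≡true⇔≡① (⟦ P ° ⟧ v)
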